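{- Let $\mathbb{A}$ be a non-empty set. The following two statements are equivalent: (1) For every finite non-empty set $C$, every map $\varphi:\mathbb{A}^+\to C$ and every $x\in\mathbb{A}^\omega$, there exists a suffix $x'$ of $x$ which admits a $\varphi$-sequentially monochromatic factorization. (2) For every finite non-empty set $C$ and every map $\varphi:\Sigma_2(\mathbb{N})\to C$, there exist $c\in C$ and an infinite set $\mathcal{N}\subseteq\mathbb{N}$ such that $\Sigma_2(\mathcal{N})\subseteq\varphi^{ -1}(c)$.
   Context: $\mathbb{A}^+$ is the free semigroup of non-empty finite words over $\mathbb{A}$ and $\mathbb{A}^\omega$ the set of right-infinite words $x=x_0x_1x_2\cdots$ with $x_i\in\mathbb{A}$. A suffix of $x$ is a word $x_nx_{n+1}\cdots$ for some $n\ge 0$. $\mathbb{N}=\{0,1,2,\dots\}$. For a set $S$, $\Sigma_2(S)$ is the set of $2$-element subsets of $S$. A map $\varphi:\mathbb{A}^+\to C$ into a finite non-empty set $C$ is called a finite coloring. A factorization $x=V_0V_1V_2\cdots$ with each $V_i\in\mathbb{A}^+$ is $\varphi$-sequentially monochromatic if there is $c\in C$ with $\varphi(V_iV_{i+1}\cdots V_{i+j})=c$ for all $i,j\ge 0$. -}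

module Defs where

open import Data.Nat using (ℕ; zero; suc; _+_; _≤_; _<_)
open import Data.Fin using (Fin)
open import Data.List using (List; []; _∷_)
open import Data.List.NonEmpty using (List⁺; _⁺++⁺_; toList) renaming (length to length⁺)
open import Data.Product using (Σ; ∃; _×_; _,_)
open import Relation.Binary.PropositionalEquality using (_≡_)

Word⁺ : Set → Set
Word⁺ A = List⁺ A

Wordω : Set → Set
Wordω A = ℕ → A

suffix : {A : Set} → Wordω A → ℕ → Wordω A
suffix x n = λ i → x (n + i)

prefix : {A : Set} → Wordω A → ℕ → List A
prefix x zero = []
prefix x (suc k) = x 0 ∷ prefix (λ i → x (suc i)) k

-- the block V_i V_{i+1} ⋯ V_{i+j}
block : {A : Set} → (ℕ → Word⁺ A) → ℕ → ℕ → Word⁺ A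
block V i zero = V i
block V i (suc j) = V i ⁺++⁺ block V (suc i) j

-- x = V₀V₁V₂⋯ : every finite concatenation V₀⋯V_n is a prefix of x
IsFactorization : {A : Set} → Wordω A → (ℕ → Word⁺ A) → Set
IsFactorization x V = ∀ n → prefix x (length⁺ (block V 0 n)) ≡ toList (block V 0 n)

SeqMonoFactorization : {A C : Set} → (Word⁺ A → C) → Wordω A → Set
SeqMonoFactorization {A} {C} φ x =
  Σ (ℕ → Word⁺ A) λ V → IsFactorization x V × Σ C λ c → ∀ i j → φ (block V i j) ≡ c

-- Statement (1); finite non-empty C is represented (up to bijection) by Fin (suc k)
Statement1 : Set → Set
Statement1 A = ∀ (k : ℕ) (φ : Word⁺ A → Fin (suc k)) (x : Wordω A) →
  Σ ℕ λ n → SeqMonoFactorization φ (suffix x n)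

-- Σ₂(ℕ): a 2-element subset {i, j} of ℕ, written with i < j
Σ₂ℕ : Set
Σ₂ℕ = Σ ℕ λ i → Σ ℕ λ j → i < j

-- an infinite subset of ℕ (given as a predicate): unbounded
Infinite : (ℕ → Set) → Set
Infinite N = ∀ m → Σ ℕ λ n → m ≤ n × N n

Statement2 : Set₁
Statement2 = ∀ (k : ℕ) (φ : Σ₂ℕ → Fin (suc k)) →
  Σ (Fin (suc k)) λ c → Σ (ℕ → Set) λ N → Infinite N ×
    (∀ i j (p : i < j) → N i → N j → φ (i , j , p) ≡ c)

module Submission where

-- Colouring the words over the constant infinite word by their length,
--   (1) yields the infinite pigeonhole principle: the lengths of V₀⋯V_n form an
--   increasing sequence of a single colour.  The pigeonhole principle gives Ramsey by
--   the classical argument: repeatedly thin an infinite reservoir to the elements whose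
--   pair with its least element (the pivot) has one fixed colour; the pivots then
--   colour every pair by the colour of the smaller pivot, and one more application of
--   the pigeonhole principle to the pivot colours gives an infinite homogeneous set.
-- * (2) ⇒ (1).  Colour the pair {i < j} by the colour of the segment x_i ⋯ x_{j-1}.
--   If a₀ < a₁ < ⋯ enumerate a homogeneous set, the factors V_n = x_{a_n} ⋯ x_{a_{n+1}-1}
--   factorize the suffix of x at a₀, and every block V_i ⋯ V_{i+j} is itself a segment
--   between two elements of the set, hence has the homogeneous colour.

open import Defs
open import Function.Bundles using (_⇔_; mk⇔)
open import Data.Nat using (ℕ; zero; suc; _+_; _∸_; _≤_; _<_; z≤n; s≤s)
open import Data.Nat.Properties
open import Data.Fin using (Fin)
open import Data.List using (_∷_; _++_; length)
open import Data.List.NonEmpty using (_⁺++⁺_; toList)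
  renaming (length to length⁺; _∷_ to _∷⁺_)
open import Data.List.NonEmpty.Properties using (length-⁺++⁺)
open import Data.Product using (Σ; _×_; _,_; proj₁; proj₂)
open import Data.Sum using (inj₁; inj₂)
open import Relation.Binary.PropositionalEquality
open import Relation.Nullary using (contradiction; yes; no)

StrictInc : (ℕ → ℕ) → Set
StrictInc s = ∀ i → s i < s (suc i)

Range : (ℕ → ℕ) → ℕ → Set
Range s m = Σ ℕ λ i → m ≡ s i

module _ {s : ℕ → ℕ} (s-inc : StrictInc s) where

  inc-mono-≤ : ∀ {i} j → i ≤ j → s i ≤ s j
  inc-mono-≤ zero z≤n = ≤-refl
  inc-mono-≤ (suc j) i≤1+j with m≤n⇒m<n∨m≡n i≤1+j
  ... | inj₁ (s≤s i≤j) = ≤-trans (inc-mono-≤ j i≤j) (<⇒≤ (s-inc j))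
  ... | inj₂ refl      = ≤-refl

  inc-mono : ∀ {i j} → i < j → s i < s j
  inc-mono {i} {j} i<j = <-≤-trans (s-inc i) (inc-mono-≤ j i<j)

  inc-reflect : ∀ {i j} → s i < s j → i < j
  inc-reflect {i} {j} si<sj with i <? j
  ... | yes i<j = i<j
  ... | no  i≮j = contradiction si<sj (≤⇒≯ (inc-mono-≤ i (≮⇒≥ i≮j)))

  -- It dominates the identity, so its range is an infinite set.
  inc-≥-id : ∀ i → i ≤ s i
  inc-≥-id zero    = z≤n
  inc-≥-id (suc i) = ≤-<-trans (inc-≥-id i) (s-inc i)

  range-infinite : Infinite (Range s)
  range-infinite m = s m , inc-≥-id m , m , refl

enumerate : ∀ {N : ℕ → Set} → Infinite N →
  Σ (ℕ → ℕ) λ a → StrictInc a × (∀ n → N (a n))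
enumerate {N} inf = a , (λ n → proj₁ (proj₂ (inf (suc (a n))))) , a∈N
  where
  a : ℕ → ℕ
  a zero    = proj₁ (inf 0)
  a (suc n) = proj₁ (inf (suc (a n)))

  a∈N : ∀ n → N (a n)
  a∈N zero    = proj₂ (proj₂ (inf 0))
  a∈N (suc n) = proj₂ (proj₂ (inf (suc (a n))))

InfinitePigeonhole : Set
InfinitePigeonhole = ∀ (k : ℕ) (f : ℕ → Fin (suc k)) →
  Σ (Fin (suc k)) λ c → Σ (ℕ → ℕ) λ s → StrictInc s × (∀ i → f (s i) ≡ c)

block-length-grows : {A : Set} (V : ℕ → Word⁺ A) → ∀ j i →
  length⁺ (block V i j) < length⁺ (block V i (suc j))
block-length-grows V zero i = begin-strict
  length⁺ (V i)                           <⟨ m<m+n (length⁺ (V i)) (s≤s z≤n) ⟩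
  length⁺ (V i) + length⁺ (V (suc i))     ≡⟨ length-⁺++⁺ (V i) (V (suc i)) ⟨
  length⁺ (V i ⁺++⁺ V (suc i))            ∎
  where open ≤-Reasoning
block-length-grows V (suc j) i = begin-strict
  length⁺ (V i ⁺++⁺ block V (suc i) j)                  ≡⟨ length-⁺++⁺ (V i) _ ⟩
  length⁺ (V i) + length⁺ (block V (suc i) j)           <⟨ +-monoʳ-< (length⁺ (V i)) (block-length-grows V j (suc i)) ⟩
  length⁺ (V i) + length⁺ (block V (suc i) (suc j))     ≡⟨ length-⁺++⁺ (V i) _ ⟨
  length⁺ (V i ⁺++⁺ block V (suc i) (suc j))            ∎
  where open ≤-Reasoning

-- Apply (1) to the constant word and the colouring "colour of the length": the
-- lengths of the initial blocks V₀⋯V_n are increasing and all of the same colour.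
statement1⇒pigeonhole : (A : Set) → A → Statement1 A → InfinitePigeonhole
statement1⇒pigeonhole A a S1 k f
  with S1 k (λ w → f (length⁺ w)) (λ _ → a)
... | _ , V , _ , c , monochromatic =
  c , (λ n → length⁺ (block V 0 n)) , (λ n → block-length-grows V n 0) , monochromatic 0

module Ramsey (pigeonhole : InfinitePigeonhole) (k : ℕ) (φ : Σ₂ℕ → Fin (suc k)) where

  φ-cong : ∀ {a b b'} (q : a < b) (q' : a < b') → b ≡ b' → φ (a , b , q) ≡ φ (a , b' , q')
  φ-cong q q' refl = cong (λ r → φ (_ , _ , r)) (≤-irrelevant q q')

  -- An infinite set of candidates, given by its increasing enumeration.
  record Reservoir : Set where
    field
      enum       : ℕ → ℕ
      increasing : StrictInc enum

    pivot : ℕ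
    pivot = enum 0
  open Reservoir

  pivot-least : (r : Reservoir) → ∀ i → pivot r < enum r (suc i)
  pivot-least r i = inc-mono (increasing r) (s≤s z≤n)

  record Thinning (r : Reservoir) : Set where
    field
      colour        : Fin (suc k)
      rest          : Reservoir
      rest-⊆        : ∀ i → Range (enum r) (enum rest i)
      beyond-pivot  : ∀ i → pivot r < enum rest i
      monochromatic : ∀ i → φ (pivot r , enum rest i , beyond-pivot i) ≡ colour
  open Thinning

  -- Thinning exists: colour every later element by its pair with the pivot and keep
  -- a monochromatic infinite subset (pigeonhole).
  thin : (r : Reservoir) → Thinning r
  thin r with pigeonhole k (λ i → φ (pivot r , enum r (suc i) , pivot-least r i))
  ... | c , s , s-inc , s-colour = record
    { colour        = c
    ; rest          = record { enum = λ i → enum r (suc (s i))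
                             ; increasing = λ i → inc-mono (increasing r) (s≤s (s-inc i)) }
    ; rest-⊆        = λ i → suc (s i) , refl
    ; beyond-pivot  = λ i → pivot-least r (s i)
    ; monochromatic = s-colour
    }

  stage : ℕ → Reservoir
  stage zero    = record { enum = λ i → i ; increasing = n<1+n }
  stage (suc n) = rest (thin (stage n))

  -- The n-th pivot and the colour it gives to all later pivots.
  pivots : ℕ → ℕ
  pivots n = pivot (stage n)

  pivotColour : ℕ → Fin (suc k)
  pivotColour n = colour (thin (stage n))

  pivots-increasing : StrictInc pivots
  pivots-increasing n = beyond-pivot (thin (stage n)) 0

  stage-⊆ : ∀ {n} m → n ≤ m → ∀ i → Range (enum (stage n)) (enum (stage m) i)
  stage-⊆ zero z≤n i = i , refl
  stage-⊆ (suc m) n≤1+m i with m≤n⇒m<n∨m≡n n≤1+m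
  ... | inj₂ refl = i , refl
  ... | inj₁ (s≤s n≤m) with rest-⊆ (thin (stage m)) i
  ...   | i' , eq with stage-⊆ m n≤m i'
  ...     | i'' , eq' = i'' , trans eq eq'

  -- Every pair of pivots n < m has the colour assigned by the smaller pivot, since
  -- pivot m lies in the (n+1)-st stage.
  pivots-colour : ∀ {n m} → n < m → (q : pivots n < pivots m) →
    φ (pivots n , pivots m , q) ≡ pivotColour n
  pivots-colour {n} {m} n<m q with stage-⊆ m n<m 0
  ... | i , eq = trans (φ-cong q (beyond-pivot (thin (stage n)) i) eq)
                       (monochromatic (thin (stage n)) i)

  -- Pigeonhole on the pivot colours yields the homogeneous infinite set.
  ramsey : Σ (Fin (suc k)) λ c → Σ (ℕ → Set) λ N → Infinite N ×
    (∀ i j (p : i < j) → N i → N j → φ (i , j , p) ≡ c)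
  ramsey with pigeonhole k pivotColour
  ... | c , t , t-inc , t-colour = c , Range g , range-infinite g-inc , homogeneous
    where
    g : ℕ → ℕ
    g i = pivots (t i)

    g-inc : StrictInc g
    g-inc i = inc-mono pivots-increasing (t-inc i)

    homogeneous : ∀ i j (p : i < j) → Range g i → Range g j → φ (i , j , p) ≡ c
    homogeneous _ _ p (a , refl) (b , refl) =
      trans (pivots-colour (inc-mono t-inc (inc-reflect g-inc p)) p) (t-colour a)

prefix-ext : {A : Set} {y z : Wordω A} → (∀ i → y i ≡ z i) → ∀ n → prefix y n ≡ prefix z n
prefix-ext eq zero    = refl
prefix-ext eq (suc n) = cong₂ _∷_ (eq 0) (prefix-ext (λ i → eq (suc i)) n)

prefix-++ : {A : Set} (y : Wordω A) → ∀ m n → prefix y (m + n) ≡ prefix y m ++ prefix (suffix y m) n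
prefix-++ y zero    n = refl
prefix-++ y (suc m) n = cong (y 0 ∷_) (prefix-++ (suffix y 1) m n)

length-prefix : {A : Set} (y : Wordω A) → ∀ n → length (prefix y n) ≡ n
length-prefix y zero    = refl
length-prefix y (suc n) = cong suc (length-prefix (suffix y 1) n)

-- The non-empty prefix y₀ ⋯ y_L of length L + 1; as a list it is  prefix y (suc L).
take⁺ : {A : Set} → Wordω A → ℕ → Word⁺ A
take⁺ y L = y 0 ∷⁺ prefix (suffix y 1) L

take⁺-ext : {A : Set} {y z : Wordω A} → (∀ i → y i ≡ z i) → ∀ L → take⁺ y L ≡ take⁺ z L
take⁺-ext eq L = cong₂ _∷⁺_ (eq 0) (prefix-ext (λ i → eq (suc i)) L)

take⁺-++ : {A : Set} (y : Wordω A) → ∀ L M →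
  take⁺ y L ⁺++⁺ take⁺ (suffix y (suc L)) M ≡ take⁺ y (L + suc M)
take⁺-++ y L M = cong (y 0 ∷⁺_) (sym (prefix-++ (suffix y 1) L (suc M)))

take⁺-isPrefix : {A : Set} (y : Wordω A) → ∀ L →
  prefix y (length⁺ (take⁺ y L)) ≡ toList (take⁺ y L)
take⁺-isPrefix y L = cong (λ n → prefix y (suc n)) (length-prefix (suffix y 1) L)

-- The segment x_i ⋯ x_{j-1} (meaningful for i < j).
segment : {A : Set} → Wordω A → ℕ → ℕ → Word⁺ A
segment x i j = take⁺ (suffix x i) (j ∸ suc i)

segment-++ : {A : Set} (x : Wordω A) → ∀ {i j l} → i < j → j < l →
  segment x i j ⁺++⁺ segment x j l ≡ segment x i l
segment-++ x {i} i<j j<l with m≤n⇒∃[o]m+o≡n i<j | m≤n⇒∃[o]m+o≡n j<l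
... | L , refl | M , refl = begin
  segment x i (suc i + L) ⁺++⁺ segment x (suc i + L) (suc (suc i + L) + M)
    ≡⟨ cong₂ _⁺++⁺_ (cong (take⁺ (suffix x i)) (m+n∸m≡n (suc i) L))
                    (cong (take⁺ (suffix x (suc i + L))) (m+n∸m≡n (suc (suc i + L)) M)) ⟩
  take⁺ (suffix x i) L ⁺++⁺ take⁺ (suffix x (suc i + L)) M
    ≡⟨ cong (take⁺ (suffix x i) L ⁺++⁺_) (take⁺-ext (λ n → cong x (shift n)) M) ⟩
  take⁺ (suffix x i) L ⁺++⁺ take⁺ (suffix (suffix x i) (suc L)) M
    ≡⟨ take⁺-++ (suffix x i) L M ⟩
  take⁺ (suffix x i) (L + suc M)
    ≡⟨ cong (take⁺ (suffix x i)) length-sum ⟨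
  segment x i (suc (suc i + L) + M)
    ∎
  where
  open ≡-Reasoning
  open import Data.Nat.Solver using (module +-*-Solver)
  open +-*-Solver

  shift : ∀ n → suc i + L + n ≡ i + (suc L + n)
  shift n = solve 3 (λ i L n → (con 1 :+ i) :+ L :+ n := i :+ ((con 1 :+ L) :+ n)) refl i L n

  length-sum : suc (suc i + L) + M ∸ suc i ≡ L + suc M
  length-sum = trans (cong (_∸ suc i) regroup) (m+n∸m≡n (suc i) (L + suc M))
    where
    regroup : suc (suc i + L) + M ≡ suc i + (L + suc M)
    regroup = solve 3 (λ i L M → con 1 :+ (con 1 :+ i :+ L) :+ M
                                 := (con 1 :+ i) :+ (L :+ (con 1 :+ M))) refl i L M

-- Cutting x at a strictly increasing sequence of positions a₀ < a₁ < ⋯ factorizes the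
-- suffix of x at a₀, and every block V_i ⋯ V_{i+j} is the segment from a_i to a_{i+j+1}.
module Cut {A : Set} (x : Wordω A) {a : ℕ → ℕ} (a-inc : StrictInc a) where

  V : ℕ → Word⁺ A
  V i = segment x (a i) (a (suc i))

  block-segment : ∀ i j → block V i j ≡ segment x (a i) (a (suc j + i))
  block-segment i zero    = refl
  block-segment i (suc j) = begin
    V i ⁺++⁺ block V (suc i) j
      ≡⟨ cong (V i ⁺++⁺_) (block-segment (suc i) j) ⟩
    segment x (a i) (a (suc i)) ⁺++⁺ segment x (a (suc i)) (a (suc j + suc i))
      ≡⟨ segment-++ x (a-inc i) (inc-mono a-inc (s≤s (m≤n+m (suc i) j))) ⟩
    segment x (a i) (a (suc j + suc i))
      ≡⟨ cong (λ n → segment x (a i) (a (suc n))) (+-suc j i) ⟩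
    segment x (a i) (a (suc (suc j) + i))
      ∎
    where open ≡-Reasoning

  cut-factorization : IsFactorization (suffix x (a 0)) V
  cut-factorization n =
    subst (λ w → prefix (suffix x (a 0)) (length⁺ w) ≡ toList w)
          (sym (block-segment 0 n))
          (take⁺-isPrefix (suffix x (a 0)) _)

-- Colour {i < j} by the colour of x_i ⋯ x_{j-1} and cut x along a homogeneous set.
statement2⇒statement1 : {A : Set} → Statement2 → Statement1 A
statement2⇒statement1 S2 k φ x with S2 k (λ { (i , j , _) → φ (segment x i j) })
... | c , N , N-infinite , homogeneous with enumerate N-infinite
...   | a , a-inc , a∈N = a 0 , V , cut-factorization , c , monochromatic
  where
  open Cut x a-inc

  monochromatic : ∀ i j → φ (block V i j) ≡ c
  monochromatic i j =
    trans (cong φ (block-segment i j))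
          (homogeneous _ _ (inc-mono a-inc (s≤s (m≤n+m i j))) (a∈N i) (a∈N (suc j + i)))

theorem2p1 : (A : Set) → A → (Statement1 A ⇔ Statement2)
theorem2p1 A a = mk⇔ statement1⇒statement2 statement2⇒statement1
  where
  statement1⇒statement2 : Statement1 A → Statement2
  statement1⇒statement2 S1 = Ramsey.ramsey (statement1⇒pigeonhole A a S1)
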